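{- For every $n\ge 2$ and every NOF problem $T_1\subset P_{NOF}$, $\mathrm{cc}(T_1,P_{NOF})\ge\mathrm{cc}(T_1,T_3)-\lceil\log_2 n\rceil$.
   Context: Indices are in $\mathbb{Z}_n$ with additions mod $n$. $T_3=\sum_{a,b,c,d\in\mathbb{Z}_n}x_{(a+b,b)}y_{(c,d+c)}z_{(b+d,a+c)}$ is the relabeled structure tensor of $(\mathbb{Z}/n\mathbb{Z})^2$ (index set $\mathbb{Z}_n^2$ on each axis), and $P_{NOF}=\sum_{i,j,k}x_{(i,j)}y_{(j,k)}z_{(k,i)}$ is the matrix multiplication tensor $\langle n,n,n\rangle$, whose support is contained in that of $T_3$. Tensors are identified with their supports; a NOF problem $T_1$ is any subset of the support of $P_{NOF}$. For supports $I\subset P$, the promise problem $(I,P)$: three players receive the three coordinates of a term of $P$ and must decide whether it lies in $I$; $\mathrm{cc}$ is deterministic communication complexity in the shared-blackboard model (players in cyclic order append bits depending on own input and the board, or accept/reject; input accepted iff all accept; correctness required only on $P$; cost = maximum bits written). -}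

module Defs where

open import Level using (0ℓ)
open import Data.Nat using (ℕ; _+_; _≤_; _∸_; _⊔_; NonZero)
open import Data.Nat.DivMod using (_mod_)
open import Data.Fin using (Fin; toℕ)
open import Data.Bool using (Bool; true; false; _∧_)
open import Data.Product using (_×_; _,_; Σ; Σ-syntax; ∃; ∃-syntax)
open import Relation.Unary using (Pred; _⊆_)
open import Relation.Binary.PropositionalEquality using (_≡_)

Zn : ℕ → Set
Zn n = Fin n

plus : (n : ℕ) .{{_ : NonZero n}} → Zn n → Zn n → Zn n
plus n a b = (toℕ a + toℕ b) mod n

Idx : ℕ → Set
Idx n = Zn n × Zn n

-- A term (monomial x_α y_β z_γ) is identified with its triple of indices;
-- a tensor is identified with its support, a predicate on triples.
Triple : ℕ → Set
Triple n = Idx n × Idx n × Idx n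

Support : ℕ → Set₁
Support n = Pred (Triple n) 0ℓ

-- Support of P_NOF = ⟨n,n,n⟩ = Σ_{i,j,k} x_(i,j) y_(j,k) z_(k,i)
PNOF : (n : ℕ) → Support n
PNOF n ((i , j) , (j' , k) , (k' , i')) = (j ≡ j') × (k ≡ k') × (i ≡ i')

T3 : (n : ℕ) .{{_ : NonZero n}} → Support n
T3 n t = Σ[ a ∈ Zn n ] Σ[ b ∈ Zn n ] Σ[ c ∈ Zn n ] Σ[ d ∈ Zn n ]
  (t ≡ ((plus n a b , b) , (c , plus n d c) , (plus n b d , plus n a c)))

-- Deterministic 3-party shared-blackboard protocols.
-- Player 1 sees the x-index, player 2 the y-index, player 3 the z-index.

data Player : Set where
  p₁ p₂ p₃ : Player

view : ∀ {n} → Player → Triple n → Idx n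
view p₁ (x , y , z) = x
view p₂ (x , y , z) = y
view p₃ (x , y , z) = z

-- The blackboard content is the path from the root.
--  * node p f l r : player p writes the bit f(own input) on the board
--                   (false → continue with l, true → continue with r);
--  * leaf a₁ a₂ a₃ : communication ends; player i accepts iff aᵢ(own input).
data Protocol (n : ℕ) : Set where
  leaf : (Idx n → Bool) → (Idx n → Bool) → (Idx n → Bool) → Protocol n
  node : Player → (Idx n → Bool) → Protocol n → Protocol n → Protocol n

run : ∀ {n} → Protocol n → Triple n → Bool
run (leaf a₁ a₂ a₃) (x , y , z) = a₁ x ∧ a₂ y ∧ a₃ z
run (node p f l r) t with f (view p t)
... | false = run l t
... | true  = run r t

cost : ∀ {n} → Protocol n → ℕ
cost (leaf _ _ _) = 0
cost (node _ _ l r) = 1 + (cost l ⊔ cost r)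

Solves : ∀ {n} → Support n → Support n → Protocol n → Set
Solves I P π = ∀ t → P t → (run π t ≡ true → I t) × (I t → run π t ≡ true)

HasProtocol : ∀ {n} → Support n → Support n → ℕ → Set
HasProtocol I P c = Σ[ π ∈ Protocol _ ] (cost π ≤ c) × Solves I P π

IsCC : ∀ {n} → Support n → Support n → ℕ → Set
IsCC I P k = HasProtocol I P k × (∀ c → HasProtocol I P c → k ≤ c)

-- Player 1 spends ⌈log₂ n⌉ bits announcing the second coordinate b of its index
-- x = (a+b, b).  A term of T₃ lies in P_NOF exactly when the first coordinate c of
-- y = (c, d+c) equals b, which player 2 can now check alone.  So player 2 adds
-- the test c = b to its acceptance condition of an optimal protocol for
-- (T₁, P_NOF): on terms of P_NOF it changes nothing, and terms outside P_NOF are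
-- rejected, as they must be since T₁ ⊆ P_NOF.
module Submission where

open import Defs
open import Data.Nat using (ℕ; zero; suc; _+_; _*_; _^_; _≤_; _<_; _∸_; _≡ᵇ_; _≤ᵇ_; _⊔_;
  z≤n; s≤s; NonZero; ⌈_/2⌉; ⌊_/2⌋)
open import Data.Nat.Properties
open import Data.Nat.Logarithm using (⌈log₂_⌉)
open import Data.Nat.Logarithm.Core using (⌈log2⌉)
open import Data.Nat.DivMod using (_mod_)
open import Data.Fin using (toℕ)
open import Data.Fin.Properties using (toℕ-injective; toℕ<n)
open import Data.Bool using (Bool; true; false; _∧_; T)
open import Data.Bool.Properties using (∧-zeroʳ)
open import Data.Product using (_,_; proj₁; proj₂)
open import Data.Empty using (⊥-elim)
open import Function using (_∘_)
open import Induction.WellFounded using (Acc; acc)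
open import Relation.Nullary using (ofʸ; ofⁿ)
open import Relation.Unary using (_⊆_)
open import Relation.Binary.PropositionalEquality

n≤2*⌈n/2⌉ : ∀ n → n ≤ 2 * ⌈ n /2⌉
n≤2*⌈n/2⌉ n = begin
  n                      ≡⟨ ⌊n/2⌋+⌈n/2⌉≡n n ⟨
  ⌊ n /2⌋ + ⌈ n /2⌉      ≤⟨ +-monoˡ-≤ ⌈ n /2⌉ (⌊n/2⌋≤⌈n/2⌉ n) ⟩
  ⌈ n /2⌉ + ⌈ n /2⌉      ≡⟨ cong (⌈ n /2⌉ +_) (+-identityʳ ⌈ n /2⌉) ⟨
  2 * ⌈ n /2⌉            ∎
  where open ≤-Reasoning

n≤2^⌈log2⌉n : ∀ n (rec : Acc _<_ n) → n ≤ 2 ^ ⌈log2⌉ n rec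
n≤2^⌈log2⌉n zero          _        = z≤n
n≤2^⌈log2⌉n (suc zero)    _        = s≤s z≤n
n≤2^⌈log2⌉n (suc (suc n)) (acc rs) = ≤-trans (n≤2*⌈n/2⌉ (suc (suc n)))
  (*-monoʳ-≤ 2 (n≤2^⌈log2⌉n (suc ⌈ n /2⌉) (rs (⌈n/2⌉<n n))))

n≤2^⌈log₂n⌉ : ∀ n → n ≤ 2 ^ ⌈log₂ n ⌉
n≤2^⌈log₂n⌉ n = n≤2^⌈log2⌉n n _

plus-comm : ∀ n .{{_ : NonZero n}} a b → plus n a b ≡ plus n b a
plus-comm n a b = cong (_mod n) (+-comm (toℕ a) (toℕ b))

module _ {n : ℕ} where

  -- Binary search: player p announces the value m (view p t), known to lie in
  -- [lo, 2^k + lo), by k comparisons, and the protocol continues with g of that value.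
  announceFrom : Player → (Idx n → ℕ) → (k lo : ℕ) → (ℕ → Protocol n) → Protocol n
  announceFrom p m zero    lo g = g lo
  announceFrom p m (suc k) lo g =
    node p (λ x → 2 ^ k + lo ≤ᵇ m x)
      (announceFrom p m k lo g) (announceFrom p m k (2 ^ k + lo) g)

  announce : Player → (Idx n → ℕ) → (k : ℕ) → (ℕ → Protocol n) → Protocol n
  announce p m k = announceFrom p m k 0

  run-announceFrom : ∀ p m k lo g t → lo ≤ m (view p t) → m (view p t) < 2 ^ k + lo →
                     run (announceFrom p m k lo g) t ≡ run (g (m (view p t))) t
  run-announceFrom p m zero lo g t lo≤v v<1+lo =
    cong (λ v → run (g v) t) (≤-antisym lo≤v (m<1+n⇒m≤n v<1+lo))
  run-announceFrom p m (suc k) lo g t lo≤v v<2^[1+k]+lo 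
    with 2 ^ k + lo ≤ᵇ m (view p t) | ≤ᵇ-reflects-≤ (2 ^ k + lo) (m (view p t))
  ... | true  | ofʸ hi≤v = run-announceFrom p m k (2 ^ k + lo) g t hi≤v
                     (subst (m (view p t) <_) 2^[1+k]+lo≡2^k+[2^k+lo] v<2^[1+k]+lo)
    where
    2^[1+k]+lo≡2^k+[2^k+lo] : 2 ^ suc k + lo ≡ 2 ^ k + (2 ^ k + lo)
    2^[1+k]+lo≡2^k+[2^k+lo] =
      trans (+-assoc (2 ^ k) (2 ^ k + 0) lo) (cong (λ w → 2 ^ k + (w + lo)) (+-identityʳ (2 ^ k)))
  ... | false | ofⁿ hi≰v = run-announceFrom p m k lo g t lo≤v (≰⇒> hi≰v)

  run-announce : ∀ p m k g t → m (view p t) < 2 ^ k →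
                 run (announce p m k g) t ≡ run (g (m (view p t))) t
  run-announce p m k g t v<2^k =
    run-announceFrom p m k 0 g t z≤n (subst (m (view p t) <_) (sym (+-identityʳ (2 ^ k))) v<2^k)

  cost-announceFrom : ∀ p m k lo g c → (∀ v → cost (g v) ≤ c) →
                      cost (announceFrom p m k lo g) ≤ k + c
  cost-announceFrom p m zero    lo g c cost-g = cost-g lo
  cost-announceFrom p m (suc k) lo g c cost-g = s≤s (⊔-lub
    (cost-announceFrom p m k lo g c cost-g) (cost-announceFrom p m k (2 ^ k + lo) g c cost-g))

  guard : Player → (Idx n → Bool) → Protocol n → Protocol n
  guard p  q (node p′ f l r) = node p′ f (guard p q l) (guard p q r)
  guard p₁ q (leaf a₁ a₂ a₃) = leaf (λ x → q x ∧ a₁ x) a₂ a₃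
  guard p₂ q (leaf a₁ a₂ a₃) = leaf a₁ (λ y → q y ∧ a₂ y) a₃
  guard p₃ q (leaf a₁ a₂ a₃) = leaf a₁ a₂ (λ z → q z ∧ a₃ z)

  run-guard : ∀ p q π t → run (guard p q π) t ≡ q (view p t) ∧ run π t
  run-guard p q (node p′ f l r) t with f (view p′ t)
  ... | false = run-guard p q l t
  ... | true  = run-guard p q r t
  run-guard p₁ q (leaf a₁ a₂ a₃) (x , y , z) with q x
  ... | true  = refl
  ... | false = refl
  run-guard p₂ q (leaf a₁ a₂ a₃) (x , y , z) with q y
  ... | true  = refl
  ... | false = ∧-zeroʳ (a₁ x)
  run-guard p₃ q (leaf a₁ a₂ a₃) (x , y , z) with q z
  ... | true  = refl
  ... | false = trans (cong (a₁ x ∧_) (∧-zeroʳ (a₂ y))) (∧-zeroʳ (a₁ x))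

  cost-guard : ∀ p q π → cost (guard p q π) ≡ cost π
  cost-guard p  q (node p′ f l r) = cong₂ (λ a b → suc (a ⊔ b)) (cost-guard p q l) (cost-guard p q r)
  cost-guard p₁ q (leaf _ _ _) = refl
  cost-guard p₂ q (leaf _ _ _) = refl
  cost-guard p₃ q (leaf _ _ _) = refl

  solves-guarded : ∀ {I P Q : Support n} {π π′ : Protocol n} (g : Triple n → Bool) →
                   I ⊆ P → Solves I P π → (∀ t → run π′ t ≡ g t ∧ run π t) →
                   (∀ {t} → Q t → T (g t) → P t) → (∀ {t} → P t → T (g t)) →
                   Solves I Q π′
  solves-guarded {P = P} g I⊆P solves run-π′ Q∧g⇒P P⇒g t Qt with g t in eq | run-π′ t
  ... | true  | run-π′≡π = (λ acc → proj₁ (solves t Pt) (trans (sym run-π′≡π) acc))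
                         , (λ It → trans run-π′≡π (proj₂ (solves t Pt) It))
    where
    Pt : P t
    Pt = Q∧g⇒P Qt (subst T (sym eq) _)
  ... | false | run-π′≡false = (λ acc → ⊥-elim (subst T (trans (sym acc) run-π′≡false) _))
                             , (λ It → ⊥-elim (subst T eq (P⇒g (I⊆P It))))

middleAgrees : ∀ {n} → Triple n → Bool
middleAgrees ((_ , j) , (j′ , _) , _) = toℕ j′ ≡ᵇ toℕ j

PNOF⇒middleAgrees : ∀ {n} {t : Triple n} → PNOF n t → T (middleAgrees t)
PNOF⇒middleAgrees {t = ((_ , j) , (j′ , _) , _)} (j≡j′ , _) =
  ≡⇒≡ᵇ (toℕ j′) (toℕ j) (cong toℕ (sym j≡j′))

T3∧middleAgrees⇒PNOF : ∀ {n} .{{_ : NonZero n}} {t : Triple n} → T3 n t → T (middleAgrees t) → PNOF n t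
T3∧middleAgrees⇒PNOF {n} (a , b , c , d , refl) c≡ᵇb
  with toℕ-injective (≡ᵇ⇒≡ (toℕ c) (toℕ b) c≡ᵇb)
... | refl = refl , plus-comm n d b , refl

announceMiddle : ∀ {n} → Protocol n → Protocol n
announceMiddle {n} π =
  announce p₁ (toℕ ∘ proj₂) ⌈log₂ n ⌉ (λ v → guard p₂ (λ y → toℕ (proj₁ y) ≡ᵇ v) π)

run-announceMiddle : ∀ {n} (π : Protocol n) t → run (announceMiddle π) t ≡ middleAgrees t ∧ run π t
run-announceMiddle {n} π t@((_ , j) , _) = trans
  (run-announce p₁ (toℕ ∘ proj₂) ⌈log₂ n ⌉ _ t (≤-trans (toℕ<n j) (n≤2^⌈log₂n⌉ n)))
  (run-guard p₂ _ π t)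

cost-announceMiddle : ∀ {n} (π : Protocol n) → cost (announceMiddle π) ≤ ⌈log₂ n ⌉ + cost π
cost-announceMiddle {n} π = cost-announceFrom p₁ (toℕ ∘ proj₂) ⌈log₂ n ⌉ 0 _ (cost π)
  (λ v → ≤-reflexive (cost-guard p₂ _ π))

PNOF-protocol⇒T3-protocol : ∀ {n} .{{_ : NonZero n}} {I : Support n} {c} → I ⊆ PNOF n →
                            HasProtocol I (PNOF n) c → HasProtocol I (T3 n) (⌈log₂ n ⌉ + c)
PNOF-protocol⇒T3-protocol {n} I⊆PNOF (π , cost-π≤c , solves) =
    announceMiddle π
  , ≤-trans (cost-announceMiddle π) (+-monoʳ-≤ ⌈log₂ n ⌉ cost-π≤c)
  , solves-guarded {π = π} {π′ = announceMiddle π} middleAgrees I⊆PNOF solves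
      (run-announceMiddle π) T3∧middleAgrees⇒PNOF PNOF⇒middleAgrees

mainTheorem19 : (n : ℕ) .{{_ : NonZero n}} → 2 ≤ n →
    (T₁ : Support n) → T₁ ⊆ PNOF n →
    (k₁ k₂ : ℕ) → IsCC T₁ (PNOF n) k₁ → IsCC T₁ (T3 n) k₂ →
    k₂ ∸ ⌈log₂ n ⌉ ≤ k₁
mainTheorem19 n _ T₁ T₁⊆PNOF k₁ k₂ (protocol₁ , _) (_ , k₂-least) =
  m≤n+o⇒m∸n≤o k₂ ⌈log₂ n ⌉ (k₂-least _ (PNOF-protocol⇒T3-protocol T₁⊆PNOF protocol₁))
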